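{- For every odd $n \in \mathbb{N}$ with $n \ge 5$, there exists an $(n,2)$-HSF $f_{n,2}$ with $\mathbf{D}[f_{n,2}] \in \left(1 + \Omega(n^{ -1})\right)\mathbf{D}[f^*_{n,2}]$, i.e. there is an absolute constant $c>0$ such that $\mathbf{D}[f_{n,2}] \ge (1 + c/n)\,\mathbf{D}[f^*_{n,2}]$ for all such $n$.
   Context: A boolean function $f:\{ -1,1\}^n\to\{ -1,1\}$ is an $(n,d)$-PTF if there is a polynomial $p\in\mathbb{R}[x_1,\dots,x_n]$ of degree at most $d$ with $f(x)=\mathrm{sgn}(p(x))$ for all $x\in\{ -1,1\}^n$. The dichromatic count $\mathbf{D}[f]$ is the number of unordered pairs $\{x,y\}$ of points of $\{ -1,1\}^n$ differing in exactly one coordinate with $f(x)\ne f(y)$. Let $p^*_{n,d}$ be the monic univariate polynomial of degree $d$ with (non-repeated) roots at the $d$ integers closest to $0$ of opposite parity from $n$, and let $f^*_{n,d}(x)=\mathrm{sgn}\left(p^*_{n,d}\left(\sum_{i=1}^n x_i\right)\right)$. An $(n,d)$-HSF (hypersensitive function) is an $(n,d)$-PTF $f$ with $\mathbf{D}[f] > \mathbf{D}[f^*_{n,d}]$. -}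

module Defs where

open import Data.Nat as ℕ using (ℕ; zero; suc)
open import Data.Bool using (Bool; true; false; not; _∧_; _xor_; if_then_else_)
open import Data.Fin using (Fin)
import Data.Fin
open import Data.Vec using (Vec; []; _∷_; lookup; _[_]%=_)
open import Data.List using (List; []; _∷_; _++_; map; concatMap; allFin)
open import Data.Nat.ListAction using (sum)
open import Data.Integer as ℤ using (ℤ)
open import Data.Rational as ℚ using (ℚ)
open import Data.Product using (Σ; _×_)
open import Relation.Binary.PropositionalEquality using (_≡_)
open import Relation.Nullary using (does)

-- A point of the Boolean cube {-1,1}^n : true ↦ +1, false ↦ -1.
Cube : ℕ → Set
Cube n = Vec Bool n

BoolFun : ℕ → Set
BoolFun n = Cube n → Bool

±1ℚ : Bool → ℚ
±1ℚ true  = ℚ.1ℚ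
±1ℚ false = ℚ.- ℚ.1ℚ

±1ℤ : Bool → ℤ
±1ℤ true  = ℤ.1ℤ
±1ℤ false = ℤ.-1ℤ

sumFinℚ : (n : ℕ) → (Fin n → ℚ) → ℚ
sumFinℚ zero    g = ℚ.0ℚ
sumFinℚ (suc n) g = g Data.Fin.zero ℚ.+ sumFinℚ n (λ i → g (Data.Fin.suc i))

record Poly2 (n : ℕ) : Set where
  constructor poly2
  field
    const : ℚ
    lin   : Fin n → ℚ
    quad  : Fin n → Fin n → ℚ

evalPoly2 : {n : ℕ} → Poly2 n → Cube n → ℚ
evalPoly2 {n} (poly2 a b c) x =
  a ℚ.+ sumFinℚ n (λ i → b i ℚ.* ±1ℚ (lookup x i))
    ℚ.+ sumFinℚ n (λ i → sumFinℚ n (λ j →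
          c i j ℚ.* (±1ℚ (lookup x i) ℚ.* ±1ℚ (lookup x j))))

SignRepresents : {n : ℕ} → Poly2 n → BoolFun n → Set
SignRepresents {n} p f =
  (x : Cube n) → (f x ≡ true → ℚ.0ℚ ℚ.< evalPoly2 p x)
               × (f x ≡ false → evalPoly2 p x ℚ.< ℚ.0ℚ)

IsPTF2 : (n : ℕ) → BoolFun n → Set
IsPTF2 n f = Σ (Poly2 n) (λ p → SignRepresents p f)

allPoints : (n : ℕ) → List (Cube n)
allPoints zero    = [] ∷ []
allPoints (suc n) = map (true ∷_) (allPoints n) ++ map (false ∷_) (allPoints n)

flip : {n : ℕ} → Cube n → Fin n → Cube n
flip x i = x [ i ]%= not

-- Dichromatic count: each edge {x, x with coordinate i flipped} is counted once,
-- from its endpoint with x_i = -1.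
D : (n : ℕ) → BoolFun n → ℕ
D n f = sum (concatMap (λ x → map (λ i →
          if not (lookup x i) ∧ (f x xor f (flip x i)) then 1 else 0)
          (allFin n)) (allPoints n))

coordSum : {n : ℕ} → Cube n → ℤ
coordSum []      = ℤ.0ℤ
coordSum (b ∷ x) = ±1ℤ b ℤ.+ coordSum x

-- p*_{n,2}: monic, roots at the 2 integers closest to 0 of parity opposite to n.
-- n even: roots -1, 1.  n odd: roots 0 and 2 (tie between ±2 broken towards +2;
-- the choice does not affect D[f*] by the symmetry x ↦ -x).
isEven : ℕ → Bool
isEven zero    = true
isEven (suc n) = not (isEven n)

pstar2 : ℕ → ℤ → ℤ
pstar2 n s = if isEven n
             then (s ℤ.- ℤ.1ℤ) ℤ.* (s ℤ.+ ℤ.1ℤ)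
             else s ℤ.* (s ℤ.- ℤ.+ 2)

fstar2 : (n : ℕ) → BoolFun n
fstar2 n x = does (ℤ.0ℤ ℤ.<? pstar2 n (coordSum x))

IsHSF2 : (n : ℕ) → BoolFun n → Set
IsHSF2 n f = IsPTF2 n f × (D n (fstar2 n) ℕ.< D n f)

ℕtoℚ : ℕ → ℚ
ℕtoℚ n = (ℤ.+ n) ℚ./ 1

-- Write n = 2s + 5, split x = (x₁, x₂, y) with y in the (2s + 3)-cube, and let t be the number of
-- +1 coordinates of y. f* is false exactly on the layer of weight s + 3 of the n-cube. The function
-- hsf is false when t = s + 2 if x₁ = x₂ = 1, when t = s + 1 if x₁ ≠ x₂, and when t ∈ {s + 1, s + 2}
-- if x₁ = x₂ = −1; it is the sign of (4V − R + 1)² − 6R² + 12R − 17, where R = x₁ + x₂ and V = Σ y,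
-- which on odd V changes sign exactly at these layers.
-- Splitting off x₁ and x₂, both dichromatic counts become combinations of A = C(2s+3, s) and
-- B = C(2s+3, s+1): D[hsf] = (3s+9)A + (5s+14)B and D[f*] = (2s+5)A + (6s+15)B. Double counting
-- the edges between two layers gives (s+3)A = (s+1)B, hence D[hsf] = D[f*] + A, and B ≤ 3A gives
-- D[f*] ≤ 10nA, so D[hsf] ≥ (1 + 1/(10n)) D[f*].

module Submission where

open import Defs
open import Data.Bool using (Bool; true; false; not; _∧_; _xor_; if_then_else_)
open import Data.Product using (Σ; ∃; _×_; _,_)
open import Data.Empty using (⊥-elim)
open import Function using (_∘_; id)
open import Relation.Binary.PropositionalEquality
import Data.Nat as ℕ
import Data.Nat.Properties as ℕ
open import Data.Rational as ℚ using (ℚ)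
import Data.Rational.Properties as ℚ

-- Dichromatic counts of functions of the weight

module _ where
  open import Data.Nat
  open import Data.Nat.Properties
  open import Algebra.Properties.CommutativeSemigroup +-commutativeSemigroup using (interchange)
  open import Data.Bool.Properties using (∧-zeroʳ)
  open import Data.Fin as Fin using (Fin)
  open import Data.Vec using ([]; _∷_; lookup)
  open import Data.List using (List; []; _∷_; _++_; map; concatMap; allFin)
  import Data.List.Properties as List
  open import Data.Nat.ListAction using (sum)
  open import Data.Nat.ListAction.Properties using (sum-++)
  open import Data.Nat.Tactic.RingSolver using (solve-∀)
  open import Relation.Nullary using (yes; no)
  open import Relation.Nullary.Decidable using (dec-true; dec-false)

  χ : Bool → ℕ
  χ b = if b then 1 else 0

  sum-map-+ : ∀ {A : Set} (g h : A → ℕ) xs →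
              sum (map (λ x → g x + h x) xs) ≡ sum (map g xs) + sum (map h xs)
  sum-map-+ g h []       = refl
  sum-map-+ g h (x ∷ xs) = trans (cong (g x + h x +_) (sum-map-+ g h xs))
                                 (interchange (g x) (h x) _ _)

  sum-concatMap : ∀ {A : Set} (g : A → List ℕ) xs → sum (concatMap g xs) ≡ sum (map (sum ∘ g) xs)
  sum-concatMap g []       = refl
  sum-concatMap g (x ∷ xs) = trans (sum-++ (g x) (concatMap g xs)) (cong (sum (g x) +_) (sum-concatMap g xs))

  sum-allFin-suc : ∀ n (h : Fin (suc n) → ℕ) →
                   sum (map h (allFin (suc n))) ≡ h Fin.zero + sum (map (h ∘ Fin.suc) (allFin n))
  sum-allFin-suc n h = cong (λ xs → h Fin.zero + sum xs)
    (trans (List.map-tabulate Fin.suc h) (sym (List.map-tabulate (λ i → i) (h ∘ Fin.suc))))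

  sumCube : (n : ℕ) → (Cube n → ℕ) → ℕ
  sumCube n g = sum (map g (allPoints n))

  sumCube-suc : ∀ n (g : Cube (suc n) → ℕ) →
                sumCube (suc n) g ≡ sumCube n (g ∘ (true ∷_)) + sumCube n (g ∘ (false ∷_))
  sumCube-suc n g = begin
    sum (map g (map (true ∷_) xs ++ map (false ∷_) xs))
      ≡⟨ cong sum (List.map-++ g (map (true ∷_) xs) _) ⟩
    sum (map g (map (true ∷_) xs) ++ map g (map (false ∷_) xs))
      ≡⟨ sum-++ (map g (map (true ∷_) xs)) _ ⟩
    sum (map g (map (true ∷_) xs)) + sum (map g (map (false ∷_) xs))
      ≡⟨ cong₂ _+_ (cong sum (List.map-∘ xs)) (cong sum (List.map-∘ xs)) ⟨
    sumCube n (g ∘ (true ∷_)) + sumCube n (g ∘ (false ∷_)) ∎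
    where open ≡-Reasoning
          xs = allPoints n

  sumCube-cong : ∀ n {g h : Cube n → ℕ} → (∀ x → g x ≡ h x) → sumCube n g ≡ sumCube n h
  sumCube-cong n eq = cong sum (List.map-cong eq (allPoints n))

  sumCube-+ : ∀ n (g h : Cube n → ℕ) → sumCube n (λ x → g x + h x) ≡ sumCube n g + sumCube n h
  sumCube-+ n g h = sum-map-+ g h (allPoints n)

  hamming : (n : ℕ) → BoolFun n → BoolFun n → ℕ
  hamming n g h = sumCube n (λ x → χ (g x xor h x))

  isCutEdge : ∀ {n} → BoolFun n → Cube n → Fin n → ℕ
  isCutEdge f x i = χ (not (lookup x i) ∧ (f x xor f (flip x i)))

  edgesAt : (n : ℕ) → BoolFun n → Cube n → ℕ
  edgesAt n f x = sum (map (isCutEdge f x) (allFin n))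

  D≡sumCube-edgesAt : ∀ n f → D n f ≡ sumCube n (edgesAt n f)
  D≡sumCube-edgesAt n f = sum-concatMap _ (allPoints n)

  D-suc : ∀ n (f : BoolFun (suc n)) →
          D (suc n) f ≡ D n (f ∘ (true ∷_)) + (hamming n (f ∘ (false ∷_)) (f ∘ (true ∷_)) + D n (f ∘ (false ∷_)))
  D-suc n f = begin
    D (suc n) f
      ≡⟨ D≡sumCube-edgesAt (suc n) f ⟩
    sumCube (suc n) (edgesAt (suc n) f)
      ≡⟨ sumCube-suc n _ ⟩
    sumCube n (λ x → edgesAt (suc n) f (true ∷ x)) + sumCube n (λ x → edgesAt (suc n) f (false ∷ x))
      ≡⟨ cong₂ _+_ (sumCube-cong n (λ x → sum-allFin-suc n (isCutEdge f (true ∷ x))))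
                   (sumCube-cong n (λ x → sum-allFin-suc n (isCutEdge f (false ∷ x)))) ⟩
    sumCube n (edgesAt n f₊) + sumCube n (λ x → χ (f₋ x xor f₊ x) + edgesAt n f₋ x)
      ≡⟨ cong₂ _+_ (sym (D≡sumCube-edgesAt n f₊)) (sumCube-+ n (λ x → χ (f₋ x xor f₊ x)) (edgesAt n f₋)) ⟩
    D n f₊ + (hamming n f₋ f₊ + sumCube n (edgesAt n f₋))
      ≡⟨ cong (λ d → D n f₊ + (hamming n f₋ f₊ + d)) (D≡sumCube-edgesAt n f₋) ⟨
    D n f₊ + (hamming n f₋ f₊ + D n f₋) ∎
    where open ≡-Reasoning
          f₊ f₋ : BoolFun n
          f₊ = f ∘ (true ∷_)
          f₋ = f ∘ (false ∷_)

  D-cong : ∀ n {f g : BoolFun n} → (∀ x → f x ≡ g x) → D n f ≡ D n g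
  D-cong n {f} {g} eq = begin
    D n f                   ≡⟨ D≡sumCube-edgesAt n f ⟩
    sumCube n (edgesAt n f) ≡⟨ sumCube-cong n (λ x → cong sum (List.map-cong (isCutEdge-cong x) (allFin n))) ⟩
    sumCube n (edgesAt n g) ≡⟨ D≡sumCube-edgesAt n g ⟨
    D n g                   ∎
    where
    open ≡-Reasoning
    isCutEdge-cong : ∀ x i → isCutEdge f x i ≡ isCutEdge g x i
    isCutEdge-cong x i = cong (λ b → χ (not (lookup x i) ∧ b)) (cong₂ _xor_ (eq x) (eq (flip x i)))

  countTrue countFalse : ∀ {n} → Cube n → ℕ
  countTrue []          = 0
  countTrue (true ∷ x)  = suc (countTrue x)
  countTrue (false ∷ x) = countTrue x
  countFalse []          = 0
  countFalse (true ∷ x)  = countFalse x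
  countFalse (false ∷ x) = suc (countFalse x)

  sumByWeight : (n : ℕ) → (ℕ → ℕ → ℕ) → ℕ
  sumByWeight zero    g = g 0 0
  sumByWeight (suc n) g = sumByWeight n (λ t f → g (suc t) f) + sumByWeight n (λ t f → g t (suc f))

  sumCube≡sumByWeight : ∀ n (g : ℕ → ℕ → ℕ) →
                        sumCube n (λ x → g (countTrue x) (countFalse x)) ≡ sumByWeight n g
  sumCube≡sumByWeight zero    g = +-identityʳ _
  sumCube≡sumByWeight (suc n) g =
    trans (sumCube-suc n _) (cong₂ _+_ (sumCube≡sumByWeight n _) (sumCube≡sumByWeight n _))

  sumByWeight-cong : ∀ n {g h : ℕ → ℕ → ℕ} → (∀ t f → t + f ≡ n → g t f ≡ h t f) →
                     sumByWeight n g ≡ sumByWeight n h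
  sumByWeight-cong zero    eq = eq 0 0 refl
  sumByWeight-cong (suc n) eq = cong₂ _+_
    (sumByWeight-cong n (λ t f t+f≡n → eq (suc t) f (cong suc t+f≡n)))
    (sumByWeight-cong n (λ t f t+f≡n → eq t (suc f) (trans (+-suc t f) (cong suc t+f≡n))))

  sumByWeight-+ : ∀ n (g h : ℕ → ℕ → ℕ) →
                  sumByWeight n (λ t f → g t f + h t f) ≡ sumByWeight n g + sumByWeight n h
  sumByWeight-+ zero    g h = refl
  sumByWeight-+ (suc n) g h =
    trans (cong₂ _+_ (sumByWeight-+ n (λ t f → g (suc t) f) (λ t f → h (suc t) f))
                     (sumByWeight-+ n (λ t f → g t (suc f)) (λ t f → h t (suc f))))
          (interchange (sumByWeight n (λ t f → g (suc t) f)) (sumByWeight n (λ t f → h (suc t) f))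
                       (sumByWeight n (λ t f → g t (suc f))) (sumByWeight n (λ t f → h t (suc f))))

  sumByWeight-*ˡ : ∀ n k (g : ℕ → ℕ → ℕ) → sumByWeight n (λ t f → k * g t f) ≡ k * sumByWeight n g
  sumByWeight-*ˡ zero    k g = refl
  sumByWeight-*ˡ (suc n) k g =
    trans (cong₂ _+_ (sumByWeight-*ˡ n k (λ t f → g (suc t) f)) (sumByWeight-*ˡ n k (λ t f → g t (suc f))))
          (sym (*-distribˡ-+ k _ _))

  sumByWeight-swap : ∀ n (g : ℕ → ℕ → ℕ) → sumByWeight n g ≡ sumByWeight n (λ t f → g f t)
  sumByWeight-swap zero    g = refl
  sumByWeight-swap (suc n) g =
    trans (cong₂ _+_ (sumByWeight-swap n (λ t f → g (suc t) f)) (sumByWeight-swap n (λ t f → g t (suc f))))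
          (+-comm (sumByWeight n (λ t f → g (suc f) t)) (sumByWeight n (λ t f → g f (suc t))))

  D-weightFun : ∀ n (P : ℕ → Bool) →
                D n (P ∘ countTrue) ≡ sumByWeight n (λ t f → f * χ (P t xor P (suc t)))
  D-weightFun zero    P = refl
  D-weightFun (suc n) P = begin
    D (suc n) (P ∘ countTrue)
      ≡⟨ D-suc n (P ∘ countTrue) ⟩
    D n (P ∘ suc ∘ countTrue) + (hamming n (P ∘ countTrue) (P ∘ suc ∘ countTrue) + D n (P ∘ countTrue))
      ≡⟨ cong₂ _+_ (D-weightFun n (P ∘ suc))
                   (cong₂ _+_ (sumCube≡sumByWeight n (λ t f → χ (P t xor P (suc t)))) (D-weightFun n P)) ⟩
    sumByWeight n (λ t f → f * χ (P (suc t) xor P (suc (suc t))))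
      + (sumByWeight n (λ t f → χ (P t xor P (suc t))) + sumByWeight n (λ t f → f * χ (P t xor P (suc t))))
      ≡⟨ cong (sumByWeight n (λ t f → f * χ (P (suc t) xor P (suc (suc t)))) +_) (sumByWeight-+ n _ _) ⟨
    sumByWeight (suc n) (λ t f → f * χ (P t xor P (suc t))) ∎
    where open ≡-Reasoning

  δ : ℕ → ℕ → ℕ
  δ k t = χ (t ≡ᵇ k)

  δ-refl : ∀ k → δ k k ≡ 1
  δ-refl k = cong χ (dec-true (k ≟ k) refl)

  δ-≢ : ∀ {k t} → t ≢ k → δ k t ≡ 0
  δ-≢ {k} {t} t≢k = cong χ (dec-false (t ≟ k) t≢k)

  layerSize : ℕ → ℕ → ℕ
  layerSize n k = sumByWeight n (λ t f → δ k t)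

  layerEdges : ℕ → ℕ → ℕ
  layerEdges n k = sumByWeight n (λ t f → f * δ k t)

  -- Double counting: the edges between layers k and k + 1 are also counted from their upper ends.
  layerEdges≡downward : ∀ n k → layerEdges n k ≡ sumByWeight n (λ t f → t * δ (suc k) t)
  layerEdges≡downward zero    k = refl
  layerEdges≡downward (suc n) k = begin
    sumByWeight n (λ t f → f * δ k (suc t)) + sumByWeight n (λ t f → δ k t + f * δ k t)
      ≡⟨ cong (sumByWeight n (λ t f → f * δ k (suc t)) +_) (sumByWeight-+ n _ _) ⟩
    sumByWeight n (λ t f → f * δ k (suc t)) + (layerSize n k + layerEdges n k)
      ≡⟨ cong₂ (λ a c → a + (layerSize n k + c)) (shift k) (layerEdges≡downward n k) ⟩
    sumByWeight n (λ t f → t * δ k t) + (layerSize n k + sumByWeight n (λ t f → t * δ (suc k) t))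
      ≡⟨ +-assoc (sumByWeight n (λ t f → t * δ k t)) _ _ ⟨
    (sumByWeight n (λ t f → t * δ k t) + layerSize n k) + sumByWeight n (λ t f → t * δ (suc k) t)
      ≡⟨ cong (_+ sumByWeight n (λ t f → t * δ (suc k) t))
              (trans (+-comm _ (layerSize n k)) (sym (sumByWeight-+ n (λ t f → δ k t) _))) ⟩
    sumByWeight n (λ t f → δ k t + t * δ k t) + sumByWeight n (λ t f → t * δ (suc k) t) ∎
    where
    open ≡-Reasoning
    t*δ0t≡0 : ∀ t → t * δ 0 t ≡ 0
    t*δ0t≡0 zero    = refl
    t*δ0t≡0 (suc t) = *-zeroʳ t
    shift : ∀ k → sumByWeight n (λ t f → f * δ k (suc t)) ≡ sumByWeight n (λ t f → t * δ k t)
    shift zero    = sumByWeight-cong n (λ t f _ → trans (*-zeroʳ f) (sym (t*δ0t≡0 t)))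
    shift (suc k) = layerEdges≡downward n k

  δ-scale : ∀ {k t} a c → (t ≡ k → a ≡ c) → a * δ k t ≡ c * δ k t
  δ-scale {k} {t} a c a≡c with t ≟ k
  ... | yes t≡k = cong (_* δ k t) (a≡c t≡k)
  ... | no  t≢k = begin
    a * δ k t ≡⟨ cong (a *_) (δ-≢ t≢k) ⟩
    a * 0     ≡⟨ *-zeroʳ a ⟩
    0         ≡⟨ *-zeroʳ c ⟨
    c * 0     ≡⟨ cong (c *_) (δ-≢ t≢k) ⟨
    c * δ k t ∎
    where open ≡-Reasoning

  layerEdges≡suc*layerSize : ∀ n k → layerEdges n k ≡ suc k * layerSize n (suc k)
  layerEdges≡suc*layerSize n k = trans (layerEdges≡downward n k)
    (trans (sumByWeight-cong n (λ t f _ → δ-scale {suc k} {t} t (suc k) id))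
           (sumByWeight-*ˡ n (suc k) (λ t f → δ (suc k) t)))

  layerEdges≡*layerSize : ∀ {n k r} → k + r ≡ n → layerEdges n k ≡ r * layerSize n k
  layerEdges≡*layerSize {n} {k} {r} k+r≡n = trans
    (sumByWeight-cong n (λ t f t+f≡n →
      δ-scale {k} {t} f r (λ { refl → +-cancelˡ-≡ t f r (trans t+f≡n (sym k+r≡n)) })))
    (sumByWeight-*ˡ n r (λ t f → δ k t))

  layerSize-sym : ∀ {n k k′} → k + k′ ≡ n → layerSize n k ≡ layerSize n k′
  layerSize-sym {n} {k} {k′} k+k′≡n =
    trans (sumByWeight-swap n (λ t f → δ k t)) (sumByWeight-cong n pointwise)
    where
    pointwise : ∀ t f → t + f ≡ n → δ k f ≡ δ k′ t
    pointwise t f t+f≡n with f ≟ k | t ≟ k′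
    ... | yes refl | yes refl = trans (δ-refl k) (sym (δ-refl k′))
    ... | no  f≢k  | no  t≢k′ = trans (δ-≢ f≢k) (sym (δ-≢ t≢k′))
    ... | yes refl | no  t≢k′ = ⊥-elim (t≢k′ (+-cancelʳ-≡ f t k′ (trans t+f≡n (trans (sym k+k′≡n) (+-comm f k′)))))
    ... | no  f≢k  | yes refl = ⊥-elim (f≢k (+-cancelˡ-≡ t f k (trans t+f≡n (trans (sym k+k′≡n) (+-comm k t)))))

  layerSize-pos : ∀ {n k} → k ≤ n → 0 < layerSize n k
  layerSize-pos {zero}  {zero}  _         = s≤s z≤n
  layerSize-pos {suc n} {zero}  _         = ≤-trans (layerSize-pos {n} z≤n) (m≤n+m _ _)
  layerSize-pos {suc n} {suc k} (s≤s k≤n) = ≤-trans (layerSize-pos k≤n) (m≤m+n _ _)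

  avoid : ℕ → ℕ → Bool
  avoid k t = not (t ≡ᵇ k)

  avoid₂ : ℕ → ℕ → ℕ → Bool
  avoid₂ k k′ t = avoid k t ∧ avoid k′ t

  offLayer : ∀ k {n} → BoolFun n
  offLayer k = avoid k ∘ countTrue

  offLayers : ∀ k k′ {n} → BoolFun n
  offLayers k k′ = avoid₂ k k′ ∘ countTrue

  ≡ᵇ-disjoint : ∀ {k k′} → k ≢ k′ → ∀ t → (t ≡ᵇ k) ∧ (t ≡ᵇ k′) ≡ false
  ≡ᵇ-disjoint {k} {k′} k≢k′ t with t ≟ k
  ... | yes refl = trans (cong ((k ≡ᵇ k) ∧_) (dec-false (k ≟ k′) k≢k′)) (∧-zeroʳ _)
  ... | no  t≢k  = cong (_∧ (t ≡ᵇ k′)) (dec-false (t ≟ k) t≢k)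

  χ-not-xor-not : ∀ a b → a ∧ b ≡ false → χ (not a xor not b) ≡ χ a + χ b
  χ-not-xor-not true  false _ = refl
  χ-not-xor-not false true  _ = refl
  χ-not-xor-not false false _ = refl

  χ-not₂-xor-not₂ : ∀ a b c → a ∧ b ≡ false → a ∧ c ≡ false → b ∧ c ≡ false →
                    χ ((not b ∧ not c) xor (not a ∧ not b)) ≡ χ a + χ c
  χ-not₂-xor-not₂ true  false false _ _ _ = refl
  χ-not₂-xor-not₂ false true  false _ _ _ = refl
  χ-not₂-xor-not₂ false false true  _ _ _ = refl
  χ-not₂-xor-not₂ false false false _ _ _ = refl

  χ-not₂-xor-not : ∀ b c → b ∧ c ≡ false → χ ((not b ∧ not c) xor not b) ≡ χ c
  χ-not₂-xor-not true  false _ = refl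
  χ-not₂-xor-not false true  _ = refl
  χ-not₂-xor-not false false _ = refl

  D-offLayer : ∀ n k → D n (offLayer (suc k)) ≡ layerEdges n (suc k) + layerEdges n k
  D-offLayer n k = begin
    D n (offLayer (suc k))
      ≡⟨ D-weightFun n (avoid (suc k)) ⟩
    sumByWeight n (λ t f → f * χ (avoid (suc k) t xor avoid k t))
      ≡⟨ sumByWeight-cong n (λ t f _ →
           trans (cong (f *_) (χ-not-xor-not (t ≡ᵇ suc k) (t ≡ᵇ k) (≡ᵇ-disjoint 1+n≢n t)))
                 (*-distribˡ-+ f (δ (suc k) t) (δ k t))) ⟩
    sumByWeight n (λ t f → f * δ (suc k) t + f * δ k t)
      ≡⟨ sumByWeight-+ n (λ t f → f * δ (suc k) t) (λ t f → f * δ k t) ⟩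
    layerEdges n (suc k) + layerEdges n k ∎
    where open ≡-Reasoning

  D-offLayers : ∀ n k → D n (offLayers (suc k) (2 + k)) ≡ layerEdges n k + layerEdges n (2 + k)
  D-offLayers n k = begin
    D n (offLayers (suc k) (2 + k))
      ≡⟨ D-weightFun n (avoid₂ (suc k) (2 + k)) ⟩
    sumByWeight n (λ t f → f * χ (avoid₂ (suc k) (2 + k) t xor avoid₂ k (suc k) t))
      ≡⟨ sumByWeight-cong n (λ t f _ →
           trans (cong (f *_) (χ-not₂-xor-not₂ (t ≡ᵇ k) (t ≡ᵇ suc k) (t ≡ᵇ 2 + k)
                                 (≡ᵇ-disjoint (<⇒≢ (n<1+n k)) t)
                                 (≡ᵇ-disjoint (<⇒≢ (m<n⇒m<1+n (n<1+n k))) t)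
                                 (≡ᵇ-disjoint (<⇒≢ (n<1+n (suc k))) t)))
                 (*-distribˡ-+ f (δ k t) (δ (2 + k) t))) ⟩
    sumByWeight n (λ t f → f * δ k t + f * δ (2 + k) t)
      ≡⟨ sumByWeight-+ n (λ t f → f * δ k t) (λ t f → f * δ (2 + k) t) ⟩
    layerEdges n k + layerEdges n (2 + k) ∎
    where open ≡-Reasoning

  hamming-offLayer : ∀ n {k k′} → k ≢ k′ → hamming n (offLayer k) (offLayer k′) ≡ layerSize n k + layerSize n k′
  hamming-offLayer n {k} {k′} k≢k′ = begin
    hamming n (offLayer k) (offLayer k′)
      ≡⟨ sumCube≡sumByWeight n (λ t f → χ (avoid k t xor avoid k′ t)) ⟩
    sumByWeight n (λ t f → χ (avoid k t xor avoid k′ t))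
      ≡⟨ sumByWeight-cong n (λ t f _ → χ-not-xor-not (t ≡ᵇ k) (t ≡ᵇ k′) (≡ᵇ-disjoint k≢k′ t)) ⟩
    sumByWeight n (λ t f → δ k t + δ k′ t)
      ≡⟨ sumByWeight-+ n (λ t f → δ k t) (λ t f → δ k′ t) ⟩
    layerSize n k + layerSize n k′ ∎
    where open ≡-Reasoning

  hamming-offLayers-offLayer : ∀ n {k k′} → k ≢ k′ → hamming n (offLayers k k′) (offLayer k) ≡ layerSize n k′
  hamming-offLayers-offLayer n {k} {k′} k≢k′ =
    trans (sumCube≡sumByWeight n (λ t f → χ (avoid₂ k k′ t xor avoid k t)))
          (sumByWeight-cong n (λ t f _ → χ-not₂-xor-not (t ≡ᵇ k) (t ≡ᵇ k′) (≡ᵇ-disjoint k≢k′ t)))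

  D-suc² : ∀ n (f : BoolFun (2 + n)) → D (2 + n) f ≡
      (D n (f ∘ (true ∷_) ∘ (true ∷_))
        + (hamming n (f ∘ (true ∷_) ∘ (false ∷_)) (f ∘ (true ∷_) ∘ (true ∷_)) + D n (f ∘ (true ∷_) ∘ (false ∷_))))
    + ((hamming n (f ∘ (false ∷_) ∘ (true ∷_)) (f ∘ (true ∷_) ∘ (true ∷_))
          + hamming n (f ∘ (false ∷_) ∘ (false ∷_)) (f ∘ (true ∷_) ∘ (false ∷_)))
      + (D n (f ∘ (false ∷_) ∘ (true ∷_))
          + (hamming n (f ∘ (false ∷_) ∘ (false ∷_)) (f ∘ (false ∷_) ∘ (true ∷_)) + D n (f ∘ (false ∷_) ∘ (false ∷_)))))
  D-suc² n f = trans (D-suc (suc n) f)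
    (cong₂ _+_ (D-suc n (f ∘ (true ∷_)))
               (cong₂ _+_ (sumCube-suc n (λ y → χ (f (false ∷ y) xor f (true ∷ y)))) (D-suc n (f ∘ (false ∷_)))))

  hsf : ∀ s {n} → BoolFun (2 + n)
  hsf s (true  ∷ true  ∷ y) = avoid (2 + s) (countTrue y)
  hsf s (true  ∷ false ∷ y) = avoid (1 + s) (countTrue y)
  hsf s (false ∷ true  ∷ y) = avoid (1 + s) (countTrue y)
  hsf s (false ∷ false ∷ y) = avoid₂ (1 + s) (2 + s) (countTrue y)

  D-hsf-layers : ∀ n s → D (2 + n) (hsf s) ≡
    3 * layerEdges n s + 3 * layerEdges n (1 + s) + 2 * layerEdges n (2 + s)
      + 2 * layerSize n (1 + s) + 4 * layerSize n (2 + s)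
  D-hsf-layers n s = begin
    D (2 + n) (hsf s)
      ≡⟨ D-suc² n (hsf s) ⟩
    _ ≡⟨ cong₂ _+_ (cong₂ _+_ (D-offLayer n (1 + s))
                              (cong₂ _+_ (hamming-offLayer n 1+s≢2+s) (D-offLayer n s)))
                   (cong₂ _+_ (cong₂ _+_ (hamming-offLayer n 1+s≢2+s) (hamming-offLayers-offLayer n 1+s≢2+s))
                              (cong₂ _+_ (D-offLayer n s)
                                         (cong₂ _+_ (hamming-offLayers-offLayer n 1+s≢2+s) (D-offLayers n s)))) ⟩
    ((E₂ + E₁) + ((C₁ + C₂) + (E₁ + E₀))) + (((C₁ + C₂) + C₂) + ((E₁ + E₀) + (C₂ + (E₀ + E₂))))
      ≡⟨ collect E₀ E₁ E₂ C₁ C₂ ⟩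
    3 * E₀ + 3 * E₁ + 2 * E₂ + 2 * C₁ + 4 * C₂ ∎
    where
    open ≡-Reasoning
    1+s≢2+s = <⇒≢ (n<1+n (suc s))
    E₀ = layerEdges n s
    E₁ = layerEdges n (1 + s)
    E₂ = layerEdges n (2 + s)
    C₁ = layerSize n (1 + s)
    C₂ = layerSize n (2 + s)
    collect : ∀ e₀ e₁ e₂ c₁ c₂ →
      ((e₂ + e₁) + ((c₁ + c₂) + (e₁ + e₀))) + (((c₁ + c₂) + c₂) + ((e₁ + e₀) + (c₂ + (e₀ + e₂))))
        ≡ 3 * e₀ + 3 * e₁ + 2 * e₂ + 2 * c₁ + 4 * c₂
    collect = solve-∀

  D-offLayer-layers : ∀ n s → D (2 + n) (offLayer (3 + s)) ≡
    layerEdges n s + 3 * layerEdges n (1 + s) + 3 * layerEdges n (2 + s) + layerEdges n (3 + s)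
      + 2 * layerSize n (1 + s) + 4 * layerSize n (2 + s) + 2 * layerSize n (3 + s)
  D-offLayer-layers n s = begin
    D (2 + n) (offLayer (3 + s))
      ≡⟨ D-suc² n (offLayer (3 + s)) ⟩
    _ ≡⟨ cong₂ _+_ (cong₂ _+_ (D-offLayer n s)
                              (cong₂ _+_ (hamming-offLayer n 2+s≢1+s) (D-offLayer n (1 + s))))
                   (cong₂ _+_ (cong₂ _+_ (hamming-offLayer n 2+s≢1+s) (hamming-offLayer n 3+s≢2+s))
                              (cong₂ _+_ (D-offLayer n (1 + s))
                                         (cong₂ _+_ (hamming-offLayer n 3+s≢2+s) (D-offLayer n (2 + s))))) ⟩
    ((E₁ + E₀) + ((C₂ + C₁) + (E₂ + E₁)))
      + (((C₂ + C₁) + (C₃ + C₂)) + ((E₂ + E₁) + ((C₃ + C₂) + (E₃ + E₂))))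
      ≡⟨ collect E₀ E₁ E₂ E₃ C₁ C₂ C₃ ⟩
    E₀ + 3 * E₁ + 3 * E₂ + E₃ + 2 * C₁ + 4 * C₂ + 2 * C₃ ∎
    where
    open ≡-Reasoning
    2+s≢1+s = >⇒≢ (n<1+n (suc s))
    3+s≢2+s = >⇒≢ (n<1+n (2 + s))
    E₀ = layerEdges n s
    E₁ = layerEdges n (1 + s)
    E₂ = layerEdges n (2 + s)
    E₃ = layerEdges n (3 + s)
    C₁ = layerSize n (1 + s)
    C₂ = layerSize n (2 + s)
    C₃ = layerSize n (3 + s)
    collect : ∀ e₀ e₁ e₂ e₃ c₁ c₂ c₃ →
      ((e₁ + e₀) + ((c₂ + c₁) + (e₂ + e₁))) + (((c₂ + c₁) + (c₃ + c₂)) + ((e₂ + e₁) + ((c₃ + c₂) + (e₃ + e₂))))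
        ≡ e₀ + 3 * e₁ + 3 * e₂ + e₃ + 2 * c₁ + 4 * c₂ + 2 * c₃
    collect = solve-∀

-- The counts in dimension 2s + 5

module _ where
  open import Data.Nat
  open import Data.Nat.Properties
  open import Data.Nat.Tactic.RingSolver using (solve-∀; solve)
  open import Data.List using ([]; _∷_)

  tailDim : ℕ → ℕ
  tailDim s = suc s + suc (suc s)

  s+[3+s]≡tailDim : ∀ s → s + (3 + s) ≡ tailDim s
  s+[3+s]≡tailDim s = +-suc s (suc (suc s))

  2+tailDim≡2s+5 : ∀ s → 2 + tailDim s ≡ 2 * s + 5
  2+tailDim≡2s+5 s = arith s
    where arith : ∀ s → 2 + (suc s + suc (suc s)) ≡ 2 * s + 5
          arith = solve-∀

  2+tailDim≡odd : ∀ s → 2 + tailDim s ≡ suc (2 * (2 + s))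
  2+tailDim≡odd s = arith s
    where arith : ∀ s → 2 + (suc s + suc (suc s)) ≡ suc (2 * (2 + s))
          arith = solve-∀

  D-hsf-tailDim : ∀ s → D (2 + tailDim s) (hsf s) ≡
    (3 * s + 9) * layerSize (tailDim s) s + (5 * s + 14) * layerSize (tailDim s) (1 + s)
  D-hsf-tailDim s = trans (D-hsf-layers (tailDim s) s)
    (collect (layerEdges≡*layerSize {k = s} (s+[3+s]≡tailDim s))
             (layerEdges≡*layerSize {k = 1 + s} refl)
             (sym (layerSize-sym {k = 1 + s} refl))
             (layerEdges≡*layerSize {k = 2 + s} (+-comm (2 + s) (1 + s))))
    where
    collect : ∀ {A B e₀ e₁ e₂ c₂} → e₀ ≡ (3 + s) * A → e₁ ≡ (2 + s) * B → c₂ ≡ B → e₂ ≡ (1 + s) * c₂ →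
              3 * e₀ + 3 * e₁ + 2 * e₂ + 2 * B + 4 * c₂ ≡ (3 * s + 9) * A + (5 * s + 14) * B
    collect {A} {B} refl refl refl refl = solve (s ∷ A ∷ B ∷ [])

  D-offLayer-tailDim : ∀ s → D (2 + tailDim s) (offLayer (3 + s)) ≡
    (2 * s + 5) * layerSize (tailDim s) s + (6 * s + 15) * layerSize (tailDim s) (1 + s)
  D-offLayer-tailDim s = trans (D-offLayer-layers (tailDim s) s)
    (collect (layerEdges≡*layerSize {k = s} (s+[3+s]≡tailDim s))
             (layerEdges≡*layerSize {k = 1 + s} refl)
             (sym (layerSize-sym {k = 1 + s} refl))
             (layerEdges≡*layerSize {k = 2 + s} (+-comm (2 + s) (1 + s)))
             (sym (layerSize-sym {k = s} (s+[3+s]≡tailDim s)))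
             (layerEdges≡*layerSize {k = 3 + s} (trans (+-comm (3 + s) s) (s+[3+s]≡tailDim s))))
    where
    collect : ∀ {A B e₀ e₁ e₂ e₃ c₂ c₃} → e₀ ≡ (3 + s) * A → e₁ ≡ (2 + s) * B →
              c₂ ≡ B → e₂ ≡ (1 + s) * c₂ → c₃ ≡ A → e₃ ≡ s * c₃ →
              e₀ + 3 * e₁ + 3 * e₂ + e₃ + 2 * B + 4 * c₂ + 2 * c₃ ≡ (2 * s + 5) * A + (6 * s + 15) * B
    collect {A} {B} refl refl refl refl refl refl = solve (s ∷ A ∷ B ∷ [])

  layerSize-tailDim-ratio : ∀ s → (3 + s) * layerSize (tailDim s) s ≡ (1 + s) * layerSize (tailDim s) (1 + s)
  layerSize-tailDim-ratio s =
    trans (sym (layerEdges≡*layerSize {k = s} (s+[3+s]≡tailDim s))) (layerEdges≡suc*layerSize (tailDim s) s)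

  module _ (s A B : ℕ) (ratio : (3 + s) * A ≡ (1 + s) * B) where

    hsfCount≡starCount+A : (3 * s + 9) * A + (5 * s + 14) * B ≡ ((2 * s + 5) * A + (6 * s + 15) * B) + A
    hsfCount≡starCount+A = begin
      (3 * s + 9) * A + (5 * s + 14) * B                ≡⟨ solve (s ∷ A ∷ B ∷ []) ⟩
      (2 * s + 6) * A + (5 * s + 14) * B + (3 + s) * A  ≡⟨ cong ((2 * s + 6) * A + (5 * s + 14) * B +_) ratio ⟩
      (2 * s + 6) * A + (5 * s + 14) * B + (1 + s) * B  ≡⟨ solve (s ∷ A ∷ B ∷ []) ⟩
      ((2 * s + 5) * A + (6 * s + 15) * B) + A          ∎
      where open ≡-Reasoning

    B≤3A : B ≤ 3 * A
    B≤3A = *-cancelˡ-≤ (1 + s) (begin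
      (1 + s) * B        ≡⟨ ratio ⟨
      (3 + s) * A        ≤⟨ *-monoˡ-≤ A (+-monoʳ-≤ 3 (m≤m+n s (2 * s))) ⟩
      (3 + 3 * s) * A    ≡⟨ solve (s ∷ A ∷ []) ⟩
      (1 + s) * (3 * A)  ∎)
      where open ≤-Reasoning

    starCount≤10*[2s+5]*A : (2 * s + 5) * A + (6 * s + 15) * B ≤ 10 * (2 * s + 5) * A
    starCount≤10*[2s+5]*A = begin
      (2 * s + 5) * A + (6 * s + 15) * B        ≡⟨ solve (s ∷ A ∷ B ∷ []) ⟩
      (2 * s + 5) * (A + 3 * B)                 ≤⟨ *-monoʳ-≤ (2 * s + 5) (+-monoʳ-≤ A (*-monoʳ-≤ 3 B≤3A)) ⟩
      (2 * s + 5) * (A + 3 * (3 * A))           ≡⟨ solve (s ∷ A ∷ []) ⟩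
      10 * (2 * s + 5) * A                      ∎
      where open ≤-Reasoning

-- Signs on the layers

module _ where
  open import Data.Nat using (ℕ; zero; suc; s≤s; z≤n)
  open import Data.Integer hiding (suc)
  import Data.Integer.Properties as ℤ
  open import Data.Integer.Tactic.RingSolver using (solve-∀)
  open import Data.Bool.Properties using (∧-zeroʳ; not-involutive)
  open import Data.Vec using ([]; _∷_)
  open import Relation.Nullary using (does)
  open import Relation.Nullary.Decidable using (dec-true; dec-false)
  open import Relation.Binary.Definitions using (tri<; tri≈; tri>)

  coordSum≡2*countTrue-n : ∀ {n} (x : Cube n) → coordSum x ≡ + 2 * + countTrue x - + n
  coordSum≡2*countTrue-n []                  = refl
  coordSum≡2*countTrue-n {suc n} (true ∷ x)  =
    trans (cong (λ z → 1ℤ + z) (coordSum≡2*countTrue-n x)) (step (+ countTrue x) (+ n))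
    where step : ∀ T N → 1ℤ + (+ 2 * T - N) ≡ + 2 * (1ℤ + T) - (1ℤ + N)
          step = solve-∀
  coordSum≡2*countTrue-n {suc n} (false ∷ x) =
    trans (cong (λ z → -1ℤ + z) (coordSum≡2*countTrue-n x)) (step (+ countTrue x) (+ n))
    where step : ∀ T N → -1ℤ + (+ 2 * T - N) ≡ + 2 * T - (1ℤ + N)
          step = solve-∀

  -- Where the layer t of the (2m + 1)-cube lies relative to its middle layers m and m + 1,
  -- indexed by the coordinate sum 2t − (2m + 1) of its points.
  data LayerPosition (m t : ℕ) : ℤ → Set where
    below : ∀ k → t ℕ.< m     → LayerPosition m t (- (+ 3 + + 2 * + k))
    lower : t ≡ m             → LayerPosition m t -1ℤ
    upper : t ≡ suc m         → LayerPosition m t 1ℤ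
    above : ∀ k → suc m ℕ.< t → LayerPosition m t (+ 3 + + 2 * + k)

  layerPosition : ∀ m t → LayerPosition m t (+ 2 * + t - + (m ℕ.+ suc m))
  layerPosition m t with ℕ.<-cmp t m
  ... | tri< t<m _ _ = let k , 1+t+k≡m = ℕ.m≤n⇒∃[o]m+o≡n t<m in
    subst (LayerPosition m t) (sym (below-value 1+t+k≡m)) (below k t<m)
    where
    below-value : ∀ {k} → suc t ℕ.+ k ≡ m → + 2 * + t - + (m ℕ.+ suc m) ≡ - (+ 3 + + 2 * + k)
    below-value {k} refl rewrite ℤ.pos-+ (suc t ℕ.+ k) (suc (suc t ℕ.+ k)) | ℤ.pos-+ t k = arith (+ t) (+ k)
      where arith : ∀ T K → + 2 * T - ((1ℤ + (T + K)) + (1ℤ + (1ℤ + (T + K)))) ≡ - (+ 3 + + 2 * K)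
            arith = solve-∀
  ... | tri≈ _ refl _ = subst (LayerPosition t t) (sym (lower-value t)) (lower refl)
    where
    lower-value : ∀ t → + 2 * + t - + (t ℕ.+ suc t) ≡ -1ℤ
    lower-value t rewrite ℤ.pos-+ t (suc t) = arith (+ t)
      where arith : ∀ T → + 2 * T - (T + (1ℤ + T)) ≡ -1ℤ
            arith = solve-∀
  ... | tri> _ _ m<t with ℕ.<-cmp t (suc m)
  ...   | tri< t<1+m _ _ = ⊥-elim (ℕ.<-irrefl refl (ℕ.<-≤-trans m<t (ℕ.≤-pred t<1+m)))
  ...   | tri≈ _ refl _ = subst (LayerPosition m (suc m)) (sym (upper-value m)) (upper refl)
    where
    upper-value : ∀ m → + 2 * + suc m - + (m ℕ.+ suc m) ≡ 1ℤ
    upper-value m rewrite ℤ.pos-+ m (suc m) = arith (+ m)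
      where arith : ∀ M → + 2 * (1ℤ + M) - (M + (1ℤ + M)) ≡ 1ℤ
            arith = solve-∀
  ...   | tri> _ _ 1+m<t = let k , 2+m+k≡t = ℕ.m≤n⇒∃[o]m+o≡n 1+m<t in
    subst (LayerPosition m t) (sym (above-value 2+m+k≡t)) (above k 1+m<t)
    where
    above-value : ∀ {k} → suc (suc m) ℕ.+ k ≡ t → + 2 * + t - + (m ℕ.+ suc m) ≡ + 3 + + 2 * + k
    above-value {k} refl rewrite ℤ.pos-+ m (suc m) | ℤ.pos-+ m k = arith (+ m) (+ k)
      where arith : ∀ M K → + 2 * (+ 2 + (M + K)) - (M + (1ℤ + M)) ≡ + 3 + + 2 * K
            arith = solve-∀

  Sign : Bool → ℤ → Set
  Sign b z = (b ≡ true → 0ℤ < z) × (b ≡ false → z < 0ℤ)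

  Sign-true : ∀ {b z} → b ≡ true → 0ℤ < z → Sign b z
  Sign-true refl 0<z = (λ _ → 0<z) , λ ()

  Sign-false : ∀ {b z} → b ≡ false → z < 0ℤ → Sign b z
  Sign-false refl z<0 = (λ ()) , λ _ → z<0

  Sign⇒does-0<? : ∀ {b z} → Sign b z → does (0ℤ <? z) ≡ b
  Sign⇒does-0<? {true}  {z} (pos , _) = dec-true (0ℤ <? z) (pos refl)
  Sign⇒does-0<? {false} {z} (_ , neg) = dec-false (0ℤ <? z) (ℤ.<-asym (neg refl))

  avoid-≢ : ∀ {k t} → t ≢ k → avoid k t ≡ true
  avoid-≢ {k} {t} t≢k = cong not (dec-false (t ℕ.≟ k) t≢k)

  avoid-refl : ∀ k → avoid k k ≡ false
  avoid-refl k = cong not (dec-true (k ℕ.≟ k) refl)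

  avoid₂-≢ : ∀ {k k′ t} → t ≢ k → t ≢ k′ → avoid₂ k k′ t ≡ true
  avoid₂-≢ t≢k t≢k′ = cong₂ _∧_ (avoid-≢ t≢k) (avoid-≢ t≢k′)

  avoid₂-reflˡ : ∀ k k′ → avoid₂ k k′ k ≡ false
  avoid₂-reflˡ k k′ = cong (_∧ avoid k′ k) (avoid-refl k)

  avoid₂-reflʳ : ∀ k k′ → avoid₂ k k′ k′ ≡ false
  avoid₂-reflʳ k k′ = trans (cong (avoid k k′ ∧_) (avoid-refl k′)) (∧-zeroʳ _)

  0<1+quadratic : ∀ {z} a b c k → z ≡ 1ℤ + (+ a * (+ k * + k) + + b * + k + + c) → 0ℤ < z
  0<1+quadratic a b c k refl = subst (0ℤ <_)
    (cong₂ (λ u v → 1ℤ + (u + v + + c)) (trans (ℤ.pos-* a _) (cong (+ a *_) (ℤ.pos-* k k))) (ℤ.pos-* b k))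
    (+<+ (s≤s z≤n))

  hsfValue : ℤ → ℤ → ℤ
  hsfValue R V = (+ 4 * V - R + 1ℤ) * (+ 4 * V - R + 1ℤ) - (+ 6 * (R * R) - + 12 * R + + 17)

  -- For literal R the right-hand sides below normalise to 1 + (64K² + bK + c) with literals b and c.
  hsfValue-below : ∀ R K →
    (+ 4 * - (+ 3 + + 2 * K) - R + 1ℤ) * (+ 4 * - (+ 3 + + 2 * K) - R + 1ℤ) - (+ 6 * (R * R) - + 12 * R + + 17)
      ≡ 1ℤ + (+ 64 * (K * K) + + 16 * (+ 11 + R) * K
              + ((+ 11 + R) * (+ 11 + R) - (+ 6 * (R * R) - + 12 * R + + 17) - 1ℤ))
  hsfValue-below = solve-∀

  hsfValue-above : ∀ R K →
    (+ 4 * (+ 3 + + 2 * K) - R + 1ℤ) * (+ 4 * (+ 3 + + 2 * K) - R + 1ℤ) - (+ 6 * (R * R) - + 12 * R + + 17)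
      ≡ 1ℤ + (+ 64 * (K * K) + + 16 * (+ 13 - R) * K
              + ((+ 13 - R) * (+ 13 - R) - (+ 6 * (R * R) - + 12 * R + + 17) - 1ℤ))
  hsfValue-above = solve-∀

  sign-hsf₊₊ : ∀ {m t V} → LayerPosition m t V → Sign (avoid (suc m) t) (hsfValue (+ 2) V)
  sign-hsf₊₊ (below k t<m)    = Sign-true (avoid-≢ (ℕ.<⇒≢ (ℕ.m<n⇒m<1+n t<m)))
                                           (0<1+quadratic 64 208 151 k (hsfValue-below (+ 2) (+ k)))
  sign-hsf₊₊ {m} (lower refl) = Sign-true (avoid-≢ (ℕ.<⇒≢ (ℕ.n<1+n m))) (+<+ (s≤s z≤n))
  sign-hsf₊₊ {m} (upper refl) = Sign-false (avoid-refl (suc m)) -<+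
  sign-hsf₊₊ (above k 1+m<t)  = Sign-true (avoid-≢ (ℕ.>⇒≢ 1+m<t))
                                           (0<1+quadratic 64 176 103 k (hsfValue-above (+ 2) (+ k)))

  sign-hsf₊₋ : ∀ {m t V} → LayerPosition m t V → Sign (avoid m t) (hsfValue 0ℤ V)
  sign-hsf₊₋ (below k t<m)    = Sign-true (avoid-≢ (ℕ.<⇒≢ t<m))
                                           (0<1+quadratic 64 176 103 k (hsfValue-below 0ℤ (+ k)))
  sign-hsf₊₋ {m} (lower refl) = Sign-false (avoid-refl m) -<+
  sign-hsf₊₋ {m} (upper refl) = Sign-true (avoid-≢ (ℕ.>⇒≢ (ℕ.n<1+n m))) (+<+ (s≤s z≤n))
  sign-hsf₊₋ (above k 1+m<t)  = Sign-true (avoid-≢ (ℕ.>⇒≢ (ℕ.<-trans (ℕ.n<1+n _) 1+m<t)))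
                                           (0<1+quadratic 64 208 151 k (hsfValue-above 0ℤ (+ k)))

  sign-hsf₋₋ : ∀ {m t V} → LayerPosition m t V → Sign (avoid₂ m (suc m) t) (hsfValue -[1+ 1 ] V)
  sign-hsf₋₋ (below k t<m)    = Sign-true (avoid₂-≢ (ℕ.<⇒≢ t<m) (ℕ.<⇒≢ (ℕ.m<n⇒m<1+n t<m)))
                                           (0<1+quadratic 64 144 15 k (hsfValue-below -[1+ 1 ] (+ k)))
  sign-hsf₋₋ {m} (lower refl) = Sign-false (avoid₂-reflˡ m (suc m)) -<+
  sign-hsf₋₋ {m} (upper refl) = Sign-false (avoid₂-reflʳ m (suc m)) -<+
  sign-hsf₋₋ (above k 1+m<t)  = Sign-true (avoid₂-≢ (ℕ.>⇒≢ (ℕ.<-trans (ℕ.n<1+n _) 1+m<t)) (ℕ.>⇒≢ 1+m<t))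
                                           (0<1+quadratic 64 240 159 k (hsfValue-above -[1+ 1 ] (+ k)))

  fstarValue-below : ∀ K → - (+ 3 + + 2 * K) * (- (+ 3 + + 2 * K) - + 2) ≡ 1ℤ + (+ 4 * (K * K) + + 16 * K + + 14)
  fstarValue-below = solve-∀

  fstarValue-above : ∀ K → (+ 3 + + 2 * K) * (+ 3 + + 2 * K - + 2) ≡ 1ℤ + (+ 4 * (K * K) + + 8 * K + + 2)
  fstarValue-above = solve-∀

  sign-fstar : ∀ {m t V} → LayerPosition m t V → Sign (avoid (suc m) t) (V * (V - + 2))
  sign-fstar (below k t<m)    = Sign-true (avoid-≢ (ℕ.<⇒≢ (ℕ.m<n⇒m<1+n t<m)))
                                         (0<1+quadratic 4 16 14 k (fstarValue-below (+ k)))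
  sign-fstar {m} (lower refl) = Sign-true (avoid-≢ (ℕ.<⇒≢ (ℕ.n<1+n m))) (+<+ (s≤s z≤n))
  sign-fstar {m} (upper refl) = Sign-false (avoid-refl (suc m)) -<+
  sign-fstar (above k 1+m<t)  = Sign-true (avoid-≢ (ℕ.>⇒≢ 1+m<t))
                                         (0<1+quadratic 4 8 2 k (fstarValue-above (+ k)))

  isEven-double : ∀ m → isEven (m ℕ.+ m) ≡ true
  isEven-double zero    = refl
  isEven-double (suc m) rewrite ℕ.+-suc m m = cong (λ b → not (not b)) (isEven-double m)

  isEven-odd : ∀ m → isEven (m ℕ.+ suc m) ≡ false
  isEven-odd m rewrite ℕ.+-suc m m = cong not (isEven-double m)

  isEven-2+tailDim : ∀ s → isEven (2 ℕ.+ tailDim s) ≡ false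
  isEven-2+tailDim s = trans (not-involutive _) (isEven-odd (suc s))

  pstar2-odd : ∀ {n} → isEven n ≡ false → ∀ z → pstar2 n z ≡ z * (z - + 2)
  pstar2-odd odd z rewrite odd = refl

  fstar2≡offLayer : ∀ s (x : Cube (2 ℕ.+ tailDim s)) → fstar2 (2 ℕ.+ tailDim s) x ≡ offLayer (3 ℕ.+ s) x
  fstar2≡offLayer s x = begin
    fstar2 (2 ℕ.+ tailDim s) x
      ≡⟨ cong (λ z → does (0ℤ <? z)) (pstar2-odd {2 ℕ.+ tailDim s} (isEven-2+tailDim s) V) ⟩
    does (0ℤ <? V * (V - + 2))
      ≡⟨ Sign⇒does-0<? (sign-fstar position) ⟩
    offLayer (3 ℕ.+ s) x ∎
    where
    open ≡-Reasoning
    V = coordSum x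
    2+tailDim≡ : 2 ℕ.+ tailDim s ≡ (2 ℕ.+ s) ℕ.+ (3 ℕ.+ s)
    2+tailDim≡ = cong (2 ℕ.+_) (sym (s+[3+s]≡tailDim s))
    position : LayerPosition (2 ℕ.+ s) (countTrue x) V
    position = subst (LayerPosition (2 ℕ.+ s) (countTrue x))
                     (sym (trans (coordSum≡2*countTrue-n x) (cong (λ n → + 2 * + countTrue x - + n) 2+tailDim≡)))
                     (layerPosition (2 ℕ.+ s) (countTrue x))

-- Integer polynomials on the cube

module _ where
  open import Data.Integer hiding (suc; _/_)
  import Data.Integer.Properties as ℤ
  open import Data.Integer.Tactic.RingSolver using (solve-∀)
  open import Algebra.Properties.Semiring.Sum ℤ.+-*-semiring
    using (sum; sum-cong-≗; ∑-distrib-+; *-distribˡ-sum; *-distribʳ-sum)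
  open import Data.Rational using (mkℚ; _/_)
  open import Data.Nat.Coprimality using (Coprime; 1-coprimeTo)
  import Data.Nat.Coprimality as Coprime
  open import Data.Fin using (Fin; zero; suc)
  open import Data.Vec using ([]; _∷_; lookup)

  ι : ℤ → ℚ
  ι z = z / 1

  coprime-1 : ∀ n → Coprime n 1
  coprime-1 n = Coprime.sym (1-coprimeTo n)

  ι≡mkℚ : ∀ z → ι z ≡ mkℚ z 0 (coprime-1 ∣ z ∣)
  ι≡mkℚ (+ n)    = ℚ.normalize-coprime (coprime-1 n)
  ι≡mkℚ -[1+ n ] = cong ℚ.-_ (ℚ.normalize-coprime (coprime-1 (ℕ.suc n)))

  ι-+ : ∀ a b → ι (a + b) ≡ ι a ℚ.+ ι b
  ι-+ a b = begin
    ι (a + b)                 ≡⟨ cong ι (cong₂ _+_ (ℤ.*-identityʳ a) (ℤ.*-identityʳ b)) ⟨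
    (a * 1ℤ + b * 1ℤ) / 1     ≡⟨ cong₂ ℚ._+_ (ι≡mkℚ a) (ι≡mkℚ b) ⟨
    ι a ℚ.+ ι b               ∎
    where open ≡-Reasoning

  ι-* : ∀ a b → ι (a * b) ≡ ι a ℚ.* ι b
  ι-* a b = sym (cong₂ ℚ._*_ (ι≡mkℚ a) (ι≡mkℚ b))

  ι-pos : ∀ {z} → 0ℤ < z → ℚ.0ℚ ℚ.< ι z
  ι-pos {z} 0<z rewrite ι≡mkℚ z = ℚ.*<* (subst (0ℤ <_) (sym (ℤ.*-identityʳ z)) 0<z)

  ι-neg : ∀ {z} → z < 0ℤ → ι z ℚ.< ℚ.0ℚ
  ι-neg {z} z<0 rewrite ι≡mkℚ z = ℚ.*<* (subst (_< 0ℤ) (sym (ℤ.*-identityʳ z)) z<0)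

  ι-mono-≤ : ∀ {a b} → a ≤ b → ι a ℚ.≤ ι b
  ι-mono-≤ {a} {b} a≤b rewrite ι≡mkℚ a | ι≡mkℚ b =
    ℚ.*≤* (subst₂ _≤_ (sym (ℤ.*-identityʳ a)) (sym (ℤ.*-identityʳ b)) a≤b)

  linForm : ∀ {n} → (Fin n → ℤ) → Cube n → ℤ
  linForm w x = sum (λ i → w i * ±1ℤ (lookup x i))

  quadForm : ∀ {n} → (Fin n → Fin n → ℤ) → Cube n → ℤ
  quadForm c x = sum (λ i → sum (λ j → c i j * (±1ℤ (lookup x i) * ±1ℤ (lookup x j))))

  integerPoly2 : ∀ {n} → ℤ → (Fin n → ℤ) → (Fin n → Fin n → ℤ) → Poly2 n
  integerPoly2 a b c = poly2 (ι a) (ι ∘ b) (λ i j → ι (c i j))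

  sumFinℚ-ι : ∀ n (g : Fin n → ℤ) → sumFinℚ n (ι ∘ g) ≡ ι (sum g)
  sumFinℚ-ι ℕ.zero    g = refl
  sumFinℚ-ι (ℕ.suc n) g = trans (cong (ι (g zero) ℚ.+_) (sumFinℚ-ι n (g ∘ suc))) (sym (ι-+ (g zero) _))

  sumFinℚ-cong : ∀ n {g h : Fin n → ℚ} → (∀ i → g i ≡ h i) → sumFinℚ n g ≡ sumFinℚ n h
  sumFinℚ-cong ℕ.zero    eq = refl
  sumFinℚ-cong (ℕ.suc n) eq = cong₂ ℚ._+_ (eq zero) (sumFinℚ-cong n (eq ∘ suc))

  ±1ℚ≡ι±1ℤ : ∀ b → ±1ℚ b ≡ ι (±1ℤ b)
  ±1ℚ≡ι±1ℤ true  = refl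
  ±1ℚ≡ι±1ℤ false = refl

  evalPoly2-integerPoly2 : ∀ {n} a b c (x : Cube n) →
                           evalPoly2 (integerPoly2 a b c) x ≡ ι (a + linForm b x + quadForm c x)
  evalPoly2-integerPoly2 {n} a b c x = begin
    ι a ℚ.+ sumFinℚ n (λ i → ι (b i) ℚ.* ±1ℚ (x′ i))
        ℚ.+ sumFinℚ n (λ i → sumFinℚ n (λ j → ι (c i j) ℚ.* (±1ℚ (x′ i) ℚ.* ±1ℚ (x′ j))))
      ≡⟨ cong₂ (λ u v → ι a ℚ.+ u ℚ.+ v)
               (trans (sumFinℚ-cong n (λ i → linear i)) (sumFinℚ-ι n _))
               (trans (sumFinℚ-cong n (λ i → trans (sumFinℚ-cong n (quadratic i)) (sumFinℚ-ι n _)))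
                      (sumFinℚ-ι n _)) ⟩
    ι a ℚ.+ ι (linForm b x) ℚ.+ ι (quadForm c x)
      ≡⟨ cong (ℚ._+ ι (quadForm c x)) (ι-+ a (linForm b x)) ⟨
    ι (a + linForm b x) ℚ.+ ι (quadForm c x)
      ≡⟨ ι-+ (a + linForm b x) (quadForm c x) ⟨
    ι (a + linForm b x + quadForm c x) ∎
    where
    open ≡-Reasoning
    x′ = lookup x
    linear : ∀ i → ι (b i) ℚ.* ±1ℚ (x′ i) ≡ ι (b i * ±1ℤ (x′ i))
    linear i = trans (cong (ι (b i) ℚ.*_) (±1ℚ≡ι±1ℤ (x′ i))) (sym (ι-* (b i) _))
    quadratic : ∀ i j → ι (c i j) ℚ.* (±1ℚ (x′ i) ℚ.* ±1ℚ (x′ j)) ≡ ι (c i j * (±1ℤ (x′ i) * ±1ℤ (x′ j)))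
    quadratic i j = trans (cong₂ (λ u v → ι (c i j) ℚ.* (u ℚ.* v)) (±1ℚ≡ι±1ℤ (x′ i)) (±1ℚ≡ι±1ℤ (x′ j)))
                          (trans (cong (ι (c i j) ℚ.*_) (sym (ι-* (±1ℤ (x′ i)) (±1ℤ (x′ j)))))
                                 (sym (ι-* (c i j) (±1ℤ (x′ i) * ±1ℤ (x′ j)))))

  sum-+-*ˡ : ∀ {n} (f g : Fin n → ℤ) δ → sum (λ i → f i + δ * g i) ≡ sum f + δ * sum g
  sum-+-*ˡ f g δ = trans (∑-distrib-+ f (λ i → δ * g i)) (cong (λ z → sum f + z) (sym (*-distribˡ-sum δ g)))

  sum-product : ∀ {n} (f g : Fin n → ℤ) → sum (λ i → sum (λ j → f i * g j)) ≡ sum f * sum g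
  sum-product f g = trans (sum-cong-≗ (λ i → sym (*-distribˡ-sum (f i) g))) (sym (*-distribʳ-sum (sum g) f))

  linForm-combination : ∀ {n} β γ (w u : Fin n → ℤ) x →
                        linForm (λ i → β * w i + γ * u i) x ≡ β * linForm w x + γ * linForm u x
  linForm-combination β γ w u x = begin
    sum (λ i → (β * w i + γ * u i) * X i)
      ≡⟨ sum-cong-≗ (λ i → distrib β γ (w i) (u i) (X i)) ⟩
    sum (λ i → β * (w i * X i) + γ * (u i * X i))
      ≡⟨ sum-+-*ˡ (λ i → β * (w i * X i)) (λ i → u i * X i) γ ⟩
    sum (λ i → β * (w i * X i)) + γ * linForm u x
      ≡⟨ cong (_+ γ * linForm u x) (*-distribˡ-sum β (λ i → w i * X i)) ⟨
    β * linForm w x + γ * linForm u x ∎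
    where
    open ≡-Reasoning
    X = ±1ℤ ∘ lookup x
    distrib : ∀ β γ w u x → (β * w + γ * u) * x ≡ β * (w * x) + γ * (u * x)
    distrib = solve-∀

  quadForm-squares : ∀ {n} δ (w u : Fin n → ℤ) x →
    quadForm (λ i j → w i * w j + δ * (u i * u j)) x ≡ linForm w x * linForm w x + δ * (linForm u x * linForm u x)
  quadForm-squares δ w u x = begin
    sum (λ i → sum (λ j → (w i * w j + δ * (u i * u j)) * (X i * X j)))
      ≡⟨ sum-cong-≗ (λ i → sum-cong-≗ (λ j → regroup δ (w i) (w j) (u i) (u j) (X i) (X j))) ⟩
    sum (λ i → sum (λ j → a i * a j + δ * (b i * b j)))
      ≡⟨ sum-cong-≗ (λ i → sum-+-*ˡ (λ j → a i * a j) (λ j → b i * b j) δ) ⟩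
    sum (λ i → sum (λ j → a i * a j) + δ * sum (λ j → b i * b j))
      ≡⟨ sum-+-*ˡ (λ i → sum (λ j → a i * a j)) (λ i → sum (λ j → b i * b j)) δ ⟩
    sum (λ i → sum (λ j → a i * a j)) + δ * sum (λ i → sum (λ j → b i * b j))
      ≡⟨ cong₂ (λ A B → A + δ * B) (sum-product a a) (sum-product b b) ⟩
    linForm w x * linForm w x + δ * (linForm u x * linForm u x) ∎
    where
    open ≡-Reasoning
    X = ±1ℤ ∘ lookup x
    a b : _ → ℤ
    a i = w i * X i
    b i = u i * X i
    regroup : ∀ δ wᵢ wⱼ uᵢ uⱼ xᵢ xⱼ →
              (wᵢ * wⱼ + δ * (uᵢ * uⱼ)) * (xᵢ * xⱼ) ≡ (wᵢ * xᵢ) * (wⱼ * xⱼ) + δ * ((uᵢ * xᵢ) * (uⱼ * xⱼ))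
    regroup = solve-∀

  sum-±1≡coordSum : ∀ {n} (y : Cube n) → sum (±1ℤ ∘ lookup y) ≡ coordSum y
  sum-±1≡coordSum []      = refl
  sum-±1≡coordSum (b ∷ y) = cong (λ z → ±1ℤ b + z) (sum-±1≡coordSum y)

  twoThenConst : ℤ → ℤ → ∀ {n} → Fin (2 ℕ.+ n) → ℤ
  twoThenConst α κ zero          = α
  twoThenConst α κ (suc zero)    = α
  twoThenConst α κ (suc (suc i)) = κ

  linForm-twoThenConst : ∀ α κ {n} p q (y : Cube n) →
    linForm (twoThenConst α κ) (p ∷ q ∷ y) ≡ α * ±1ℤ p + (α * ±1ℤ q + κ * coordSum y)
  linForm-twoThenConst α κ p q y = cong (λ z → α * ±1ℤ p + (α * ±1ℤ q + z))
    (trans (sym (*-distribˡ-sum κ (±1ℤ ∘ lookup y))) (cong (κ *_) (sum-±1≡coordSum y)))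

  weightsL weightsR : ∀ {n} → Fin (2 ℕ.+ n) → ℤ
  weightsL = twoThenConst -1ℤ (+ 4)
  weightsR = twoThenConst 1ℤ 0ℤ

  hsfLinear : ∀ {n} → Fin (2 ℕ.+ n) → ℤ
  hsfLinear i = + 2 * weightsL i + + 12 * weightsR i

  hsfQuadratic : ∀ {n} → Fin (2 ℕ.+ n) → Fin (2 ℕ.+ n) → ℤ
  hsfQuadratic i j = weightsL i * weightsL j + - + 6 * (weightsR i * weightsR j)

  -- (L + 1)² − 6R² + 12R − 17 for the linear forms L = 4(x₃ + ⋯ + xₙ) − x₁ − x₂ and R = x₁ + x₂.
  hsfPoly : ∀ {n} → Poly2 (2 ℕ.+ n)
  hsfPoly = integerPoly2 (- + 16) hsfLinear hsfQuadratic

  evalPoly2-hsfPoly : ∀ {n} p q (y : Cube n) →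
                      evalPoly2 hsfPoly (p ∷ q ∷ y) ≡ ι (hsfValue (±1ℤ p + ±1ℤ q) (coordSum y))
  evalPoly2-hsfPoly p q y = trans (evalPoly2-integerPoly2 (- + 16) hsfLinear hsfQuadratic x) (cong ι (begin
    - + 16 + linForm hsfLinear x + quadForm hsfQuadratic x
      ≡⟨ cong₂ (λ l r → - + 16 + l + r) (linForm-combination (+ 2) (+ 12) weightsL weightsR x)
                                         (quadForm-squares (- + 6) weightsL weightsR x) ⟩
    - + 16 + (+ 2 * L + + 12 * R) + (L * L + - + 6 * (R * R))
      ≡⟨ cong₂ (λ L R → - + 16 + (+ 2 * L + + 12 * R) + (L * L + - + 6 * (R * R)))
               (linForm-twoThenConst -1ℤ (+ 4) p q y) (linForm-twoThenConst 1ℤ 0ℤ p q y) ⟩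
    _ ≡⟨ complete-square (±1ℤ p) (±1ℤ q) (coordSum y) ⟩
    hsfValue (±1ℤ p + ±1ℤ q) (coordSum y) ∎))
    where
    open ≡-Reasoning
    x = p ∷ q ∷ y
    L = linForm weightsL x
    R = linForm weightsR x
    complete-square : ∀ P Q V →
      let L = -1ℤ * P + (-1ℤ * Q + + 4 * V) ; R = 1ℤ * P + (1ℤ * Q + 0ℤ * V) in
      - + 16 + (+ 2 * L + + 12 * R) + (L * L + - + 6 * (R * R))
        ≡ (+ 4 * V - (P + Q) + 1ℤ) * (+ 4 * V - (P + Q) + 1ℤ) - (+ 6 * ((P + Q) * (P + Q)) - + 12 * (P + Q) + + 17)
    complete-square = solve-∀

  Sign-ι : ∀ {b z e} → e ≡ ι z → Sign b z → (b ≡ true → ℚ.0ℚ ℚ.< e) × (b ≡ false → e ℚ.< ℚ.0ℚ)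
  Sign-ι refl (pos , neg) = (λ b≡t → ι-pos (pos b≡t)) , (λ b≡f → ι-neg (neg b≡f))

  hsfPoly-represents : ∀ s → SignRepresents hsfPoly (hsf s {tailDim s})
  hsfPoly-represents s (p ∷ q ∷ y) = Sign-ι (evalPoly2-hsfPoly p q y) (row p q)
    where
    position : LayerPosition (ℕ.suc s) (countTrue y) (coordSum y)
    position = subst (LayerPosition (ℕ.suc s) (countTrue y)) (sym (coordSum≡2*countTrue-n y))
                     (layerPosition (ℕ.suc s) (countTrue y))
    row : ∀ p q → Sign (hsf s (p ∷ q ∷ y)) (hsfValue (±1ℤ p + ±1ℤ q) (coordSum y))
    row true  true  = sign-hsf₊₊ position
    row true  false = sign-hsf₊₋ position
    row false true  = sign-hsf₊₋ position
    row false false = sign-hsf₋₋ position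

-- The rational inequality

module _ where
  open import Data.Integer using (+_; +≤+; +<+)
  import Data.Integer.Properties as ℤ
  open import Data.Rational using (_/_)
  open import Data.Rational.Solver using (module +-*-Solver)
  open +-*-Solver

  ℕtoℚ-+ : ∀ a b → ℕtoℚ (a ℕ.+ b) ≡ ℕtoℚ a ℚ.+ ℕtoℚ b
  ℕtoℚ-+ a b = trans (cong ι (ℤ.pos-+ a b)) (ι-+ (+ a) (+ b))

  ℕtoℚ-* : ∀ a b → ℕtoℚ (a ℕ.* b) ≡ ℕtoℚ a ℚ.* ℕtoℚ b
  ℕtoℚ-* a b = trans (cong ι (ℤ.pos-* a b)) (ι-* (+ a) (+ b))

  tenth : ℚ
  tenth = + 1 / 10

  0<tenth : ℚ.0ℚ ℚ.< tenth
  0<tenth = ℚ.*<* (+<+ (ℕ.s≤s ℕ.z≤n))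

  tenth-gain : ∀ n X A → X ℕ.≤ 10 ℕ.* n ℕ.* A →
               (ℕtoℚ n ℚ.+ tenth) ℚ.* ℕtoℚ X ℚ.≤ ℕtoℚ n ℚ.* ℕtoℚ (X ℕ.+ A)
  tenth-gain n X A X≤10nA = begin
    (N ℚ.+ tenth) ℚ.* ℕtoℚ X
      ≡⟨ solve 2 (λ N X → (N :+ con tenth) :* X := N :* X :+ X :* con tenth) refl N (ℕtoℚ X) ⟩
    N ℚ.* ℕtoℚ X ℚ.+ ℕtoℚ X ℚ.* tenth
      ≤⟨ ℚ.+-monoʳ-≤ (N ℚ.* ℕtoℚ X) (ℚ.*-monoʳ-≤-nonNeg tenth (ι-mono-≤ (+≤+ X≤10nA))) ⟩
    N ℚ.* ℕtoℚ X ℚ.+ ℕtoℚ (10 ℕ.* n ℕ.* A) ℚ.* tenth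
      ≡⟨ cong (λ z → N ℚ.* ℕtoℚ X ℚ.+ z ℚ.* tenth)
              (trans (ℕtoℚ-* (10 ℕ.* n) A) (cong (ℚ._* ℕtoℚ A) (ℕtoℚ-* 10 n))) ⟩
    N ℚ.* ℕtoℚ X ℚ.+ (ℕtoℚ 10 ℚ.* N ℚ.* ℕtoℚ A) ℚ.* tenth
      ≡⟨ solve 3 (λ N X A → N :* X :+ (con (ℕtoℚ 10) :* N :* A) :* con tenth := N :* (X :+ A))
               refl N (ℕtoℚ X) (ℕtoℚ A) ⟩
    N ℚ.* (ℕtoℚ X ℚ.+ ℕtoℚ A)
      ≡⟨ cong (N ℚ.*_) (ℕtoℚ-+ X A) ⟨
    N ℚ.* ℕtoℚ (X ℕ.+ A) ∎
    where
    open ℚ.≤-Reasoning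
    N = ℕtoℚ n

HSFWithGain : ℚ → ℕ.ℕ → Set
HSFWithGain c n = Σ (BoolFun n) (λ f → IsHSF2 n f ×
  ((ℕtoℚ n ℚ.+ c) ℚ.* ℕtoℚ (D n (fstar2 n)) ℚ.≤ ℕtoℚ n ℚ.* ℕtoℚ (D n f)))

hsf-gain : ∀ s → HSFWithGain tenth (2 ℕ.+ tailDim s)
hsf-gain s = hsf s , ((hsfPoly , hsfPoly-represents s) , D*<D) , gain
  where
  n = 2 ℕ.+ tailDim s
  A = layerSize (tailDim s) s
  B = layerSize (tailDim s) (1 ℕ.+ s)
  D* = D n (fstar2 n)
  D*≡ : D* ≡ (2 ℕ.* s ℕ.+ 5) ℕ.* A ℕ.+ (6 ℕ.* s ℕ.+ 15) ℕ.* B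
  D*≡ = trans (D-cong n (fstar2≡offLayer s)) (D-offLayer-tailDim s)
  D≡D*+A : D n (hsf s) ≡ D* ℕ.+ A
  D≡D*+A = trans (D-hsf-tailDim s)
             (trans (hsfCount≡starCount+A s A B (layerSize-tailDim-ratio s)) (cong (ℕ._+ A) (sym D*≡)))
  D*<D : D* ℕ.< D n (hsf s)
  D*<D = subst (D* ℕ.<_) (sym D≡D*+A)
           (ℕ.m<m+n D* (layerSize-pos {tailDim s} {s} (ℕ.≤-trans (ℕ.n≤1+n s) (ℕ.m≤m+n (ℕ.suc s) _))))
  D*≤10nA : D* ℕ.≤ 10 ℕ.* n ℕ.* A
  D*≤10nA = begin
    D*                                                   ≡⟨ D*≡ ⟩
    (2 ℕ.* s ℕ.+ 5) ℕ.* A ℕ.+ (6 ℕ.* s ℕ.+ 15) ℕ.* B     ≤⟨ starCount≤10*[2s+5]*A s A B (layerSize-tailDim-ratio s) ⟩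
    10 ℕ.* (2 ℕ.* s ℕ.+ 5) ℕ.* A                         ≡⟨ cong (λ m → 10 ℕ.* m ℕ.* A) (2+tailDim≡2s+5 s) ⟨
    10 ℕ.* n ℕ.* A                                       ∎
    where open ℕ.≤-Reasoning
  gain : (ℕtoℚ n ℚ.+ tenth) ℚ.* ℕtoℚ D* ℚ.≤ ℕtoℚ n ℚ.* ℕtoℚ (D n (hsf s))
  gain = subst (λ d → (ℕtoℚ n ℚ.+ tenth) ℚ.* ℕtoℚ D* ℚ.≤ ℕtoℚ n ℚ.* ℕtoℚ d) (sym D≡D*+A)
               (tenth-gain n D* A D*≤10nA)

open import Data.Nat using (ℕ; _≤_; _*_)

mainTheorem3 : Σ ℚ (λ c → (ℚ.0ℚ ℚ.< c) ×
    ((n : ℕ) → (∃ λ k → n ≡ ℕ.suc (2 * k)) → 5 ≤ n →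
      Σ (BoolFun n) (λ f → IsHSF2 n f ×
        ((ℕtoℚ n ℚ.+ c) ℚ.* ℕtoℚ (D n (fstar2 n))
          ℚ.≤ ℕtoℚ n ℚ.* ℕtoℚ (D n f)))))
mainTheorem3 = tenth , 0<tenth , witness
  where
  witness : (n : ℕ) → (∃ λ k → n ≡ ℕ.suc (2 * k)) → 5 ≤ n → HSFWithGain tenth n
  witness _ (0 , refl) (ℕ.s≤s ())
  witness _ (1 , refl) (ℕ.s≤s (ℕ.s≤s (ℕ.s≤s ())))
  witness _ (ℕ.suc (ℕ.suc s) , refl) _ = subst (HSFWithGain tenth) (2+tailDim≡odd s) (hsf-gain s)
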